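{- Let $\pi$ be a permutation avoiding both patterns $1243$ and $2134$, and suppose $\pi$ has at least one mid-$123$ entry. Let $b$ be the last (rightmost) mid-$123$ entry of $\pi$. Then there is a unique entry $c$ such that $b c$ forms the "$23$" of a $123$ pattern in $\pi$, i.e. there is exactly one entry $c$ of $\pi$ located to the right of $b$ with $c>b$ for which some entry $a<b$ lies to the left of $b$.
   Context: Let $\pi=\pi_1\cdots\pi_n$ be a permutation. An entry $\pi_i$ is a mid-$123$ entry if there exist $h<i<l$ with $\pi_h<\pi_i<\pi_l$. A permutation $\pi$ avoids a pattern $p=p_1\cdots p_m$ if there are no indices $i_1<\dots<i_m$ such that $\pi_{i_1},\dots,\pi_{i_m}$ are in the same relative order as $p_1,\dots,p_m$. -}

module Defs where

open import Data.Nat using (ℕ)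
open import Data.Fin using (Fin; zero; suc; _<_)
open import Data.Vec using (Vec; lookup; _∷_; [])
open import Data.Product using (Σ; _×_; _,_)
open import Function.Definitions using (Injective)
open import Function.Bundles using (_⇔_)
open import Relation.Binary.PropositionalEquality using (_≡_; refl; sym; trans; cong)
open import Relation.Nullary using (¬_)

-- A permutation of length n: an injective (hence bijective) map Fin n → Fin n;
-- fun π i is the entry in position i (positions and values are 0-based).
record Perm (n : ℕ) : Set where
  constructor perm
  field
    fun : Fin n → Fin n
    injective : Injective _≡_ _≡_ fun
open Perm public

Contains : {n m : ℕ} → Perm n → Perm m → Set
Contains {n} {m} π p =
  Σ (Fin m → Fin n) λ f →
    (∀ j k → j < k → f j < f k) ×
    (∀ j k → (fun p j < fun p k) ⇔ (fun π (f j) < fun π (f k)))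

Avoids : {n m : ℕ} → Perm n → Perm m → Set
Avoids π p = ¬ Contains π p

f1243 : Fin 4 → Fin 4
f1243 zero = zero
f1243 (suc zero) = suc zero
f1243 (suc (suc zero)) = suc (suc (suc zero))
f1243 (suc (suc (suc zero))) = suc (suc zero)

f2134 : Fin 4 → Fin 4
f2134 zero = suc zero
f2134 (suc zero) = zero
f2134 (suc (suc zero)) = suc (suc zero)
f2134 (suc (suc (suc zero))) = suc (suc (suc zero))

f1243-invol : ∀ i → f1243 (f1243 i) ≡ i
f1243-invol zero = refl
f1243-invol (suc zero) = refl
f1243-invol (suc (suc zero)) = refl
f1243-invol (suc (suc (suc zero))) = refl

f2134-invol : ∀ i → f2134 (f2134 i) ≡ i
f2134-invol zero = refl
f2134-invol (suc zero) = refl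
f2134-invol (suc (suc zero)) = refl
f2134-invol (suc (suc (suc zero))) = refl

private
  invol-inj : (f : Fin 4 → Fin 4) → (∀ i → f (f i) ≡ i) → Injective _≡_ _≡_ f
  invol-inj f h {x} {y} e =
    trans (sym (h x)) (trans (cong f e) (h y))

p1243 : Perm 4
p1243 = perm f1243 (invol-inj f1243 f1243-invol)

p2134 : Perm 4
p2134 = perm f2134 (invol-inj f2134 f2134-invol)

Mid123 : {n : ℕ} → Perm n → Fin n → Set
Mid123 {n} π i =
  Σ (Fin n) λ h → Σ (Fin n) λ l →
    h < i × i < l × fun π h < fun π i × fun π i < fun π l

LastMid123 : {n : ℕ} → Perm n → Fin n → Set
LastMid123 π i = Mid123 π i × (∀ j → i < j → ¬ Mid123 π j)

-- Let h < b < l witness that b is the last mid-123 entry, and let c > b be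
-- another entry to the right of b with a larger value. Of the two entries c, l
-- take the left one x and the right one y. If π x < π y, then h x y is a 123
-- whose middle lies right of b, contradicting the choice of b; if π x > π y,
-- then h b x y is an occurrence of 1243.
module Submission where

open import Defs
open import Data.Nat as ℕ using (ℕ; z<s; s<s)
open import Data.Fin using (Fin; _<_; zero; suc; inject₁)
open import Data.Fin.Properties using (<-trans; <-irrefl; <-asym; <-cmp)
open import Data.Vec using (lookup; _∷_; [])
open import Data.Product using (Σ; _×_; _,_)
open import Data.Empty using (⊥; ⊥-elim)
open import Function.Bundles using (mk⇔)
open import Relation.Binary using (_Preserves_⟶_; tri<; tri≈; tri>)
open import Relation.Binary.PropositionalEquality using (_≡_; refl; cong)
open import Relation.Nullary using (¬_)

strictlyMonotone-fromSteps : {m n : ℕ} (f : Fin (ℕ.suc m) → Fin n) →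
  (∀ i → f (inject₁ i) < f (suc i)) → f Preserves _<_ ⟶ _<_
strictlyMonotone-fromSteps {ℕ.suc m} f step {zero} {suc zero} _ = step zero
strictlyMonotone-fromSteps {ℕ.suc m} f step {zero} {suc (suc k)} _ =
  <-trans (step zero)
    (strictlyMonotone-fromSteps (λ i → f (suc i)) (λ i → step (suc i)) {zero} {suc k} z<s)
strictlyMonotone-fromSteps {ℕ.suc m} f step {suc j} {suc k} (s<s j<k) =
  strictlyMonotone-fromSteps (λ i → f (suc i)) (λ i → step (suc i)) j<k

contains-byEmbedding : {m n : ℕ} (π : Perm n) (p : Perm m) (g φ : Fin m → Fin n) →
  g Preserves _<_ ⟶ _<_ → φ Preserves _<_ ⟶ _<_ →
  (∀ j → fun π (g j) ≡ φ (fun p j)) → Contains π p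
contains-byEmbedding π p g φ g-mono φ-mono πg≡φp =
  g , (λ _ _ → g-mono) , λ j k → mk⇔ (forward j k) (backward j k)
  where
    forward : ∀ j k → fun p j < fun p k → fun π (g j) < fun π (g k)
    forward j k pj<pk rewrite πg≡φp j | πg≡φp k = φ-mono pj<pk

    backward : ∀ j k → fun π (g j) < fun π (g k) → fun p j < fun p k
    backward j k πgj<πgk with <-cmp (fun p j) (fun p k)
    ... | tri< pj<pk _ _ = pj<pk
    ... | tri≈ _ pj≡pk _ =
      ⊥-elim (<-irrefl (cong (λ i → fun π (g i)) (injective p pj≡pk)) πgj<πgk)
    ... | tri> _ _ pk<pj = ⊥-elim (<-asym πgj<πgk (forward k j pk<pj))

contains-1243 : {n : ℕ} (π : Perm n) {i₀ i₁ i₂ i₃ : Fin n} →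
  i₀ < i₁ → i₁ < i₂ → i₂ < i₃ →
  fun π i₀ < fun π i₁ → fun π i₁ < fun π i₃ → fun π i₃ < fun π i₂ →
  Contains π p1243
contains-1243 π {i₀} {i₁} {i₂} {i₃} i₀<i₁ i₁<i₂ i₂<i₃ v₀<v₁ v₁<v₃ v₃<v₂ =
  contains-byEmbedding π p1243 positions values
    (strictlyMonotone-fromSteps positions positions-steps)
    (strictlyMonotone-fromSteps values values-steps)
    positions-embed
  where
    positions values : Fin 4 → Fin _
    positions = lookup (i₀ ∷ i₁ ∷ i₂ ∷ i₃ ∷ [])
    values = lookup (fun π i₀ ∷ fun π i₁ ∷ fun π i₃ ∷ fun π i₂ ∷ [])

    positions-steps : ∀ i → positions (inject₁ i) < positions (suc i)
    positions-steps zero = i₀<i₁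
    positions-steps (suc zero) = i₁<i₂
    positions-steps (suc (suc zero)) = i₂<i₃

    values-steps : ∀ i → values (inject₁ i) < values (suc i)
    values-steps zero = v₀<v₁
    values-steps (suc zero) = v₁<v₃
    values-steps (suc (suc zero)) = v₃<v₂

    positions-embed : ∀ j → fun π (positions j) ≡ values (f1243 j)
    positions-embed zero = refl
    positions-embed (suc zero) = refl
    positions-embed (suc (suc zero)) = refl
    positions-embed (suc (suc (suc zero))) = refl

no-two-larger-right-of-lastMid123 : {n : ℕ} (π : Perm n) → Avoids π p1243 →
  {h b x y : Fin n} → h < b → fun π h < fun π b → (∀ j → b < j → ¬ Mid123 π j) →
  b < x → x < y → fun π b < fun π x → fun π b < fun π y → ⊥
no-two-larger-right-of-lastMid123 π avoids {h} {b} {x} {y} h<b πh<πb last b<x x<y πb<πx πb<πy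
  with <-cmp (fun π x) (fun π y)
... | tri< πx<πy _ _ =
  last x b<x (h , y , <-trans h<b b<x , x<y , <-trans πh<πb πb<πx , πx<πy)
... | tri≈ _ πx≡πy _ = <-irrefl (injective π πx≡πy) x<y
... | tri> _ _ πy<πx = avoids (contains-1243 π h<b b<x x<y πh<πb πb<πy πy<πx)

lemma2 : {n : ℕ} (π : Perm n) → Avoids π p1243 → Avoids π p2134 →
    (b : Fin n) → LastMid123 π b →
    Σ (Fin n) λ c →
      (b < c × fun π b < fun π c × Σ (Fin n) (λ a → a < b × fun π a < fun π b)) ×
      (∀ c′ → b < c′ → fun π b < fun π c′ →
        Σ (Fin n) (λ a → a < b × fun π a < fun π b) → c′ ≡ c)
lemma2 π avoids _ b ((h , l , h<b , b<l , πh<πb , πb<πl) , last) =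
  l , (b<l , πb<πl , (h , h<b , πh<πb)) , unique
  where
    unique : ∀ c′ → b < c′ → fun π b < fun π c′ →
      Σ (Fin _) (λ a → a < b × fun π a < fun π b) → c′ ≡ l
    unique c′ b<c′ πb<πc′ _ with <-cmp c′ l
    ... | tri< c′<l _ _ = ⊥-elim (no-two-larger-right-of-lastMid123 π avoids
                            h<b πh<πb last b<c′ c′<l πb<πc′ πb<πl)
    ... | tri≈ _ c′≡l _ = c′≡l
    ... | tri> _ _ l<c′ = ⊥-elim (no-two-larger-right-of-lastMid123 π avoids
                            h<b πh<πb last b<l l<c′ πb<πl πb<πc′)
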